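{- Let $n\in\mathbb{N}$ and let $h,t\in\mathbb{Z}_{\ge0}$ with $0\le h\le 4$ and $1\le t\le F_n$. Then (i) $a_{5(F_{n+1}-1)+hF_n+t+1} = 5F_{n+2}-4+hF_{n+1}+\lfloor (F_{n+1}+1+t)\varphi\rfloor-\lfloor (F_{n+1}+1)\varphi\rfloor$; (ii) $b_{5(F_{n+1}-1)+hF_n+t+1} = 5F_{n+3}+hF_{n+2}-3+t+\lfloor (F_{n+1}+1+t)\varphi\rfloor-\lfloor (F_{n+1}+1)\varphi\rfloor$.
   Context: $\varphi=\frac{1+\sqrt5}{2}$. $F_1=F_2=1$, $F_{i+2}=F_{i+1}+F_i$ is the Fibonacci sequence. Let $\sigma$ be the substitution on finite lists over $\{1,2\}$ acting letterwise by $\sigma(1)=2$, $\sigma(2)=2,1$. Let $C_1=(1,1,1,1,1)$ and $C_{i+1}=\sigma(C_i)$. Let $(c_n)_{n\in\mathbb{N}}$ be the infinite sequence obtained by concatenating $C_1, C_2, C_3, \dots$ in this order, and let $d_n=c_n+1$. Define $a_n = 6+\sum_{i=1}^{n-1} c_i$ and $b_n=12+\sum_{i=1}^{n-1} d_i$ for $n\in\mathbb{N}$. -}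

module Defs where

open import Data.Nat using (ℕ; zero; suc; _+_; _*_; _∸_; _^_; _≤ᵇ_)
open import Data.Bool using (Bool; true; false; if_then_else_)
open import Data.List using (List; []; _∷_; _++_; concatMap; take; map)
open import Data.Nat.ListAction using (sum)
open import Data.Maybe using (Maybe; just; nothing)

F : ℕ → ℕ
F zero = zero
F (suc zero) = 1
F (suc (suc i)) = F (suc i) + F i

-- ⌊ m φ ⌋ for m : ℕ, φ = (1+√5)/2, computed exactly without reals.
-- For k m : ℕ,  k ≤ m φ  ⇔  2k - m ≤ m √5  ⇔  (2k ≤ m) ∨ (2k - m)² ≤ 5 m²,
-- which is what  leφ m k  tests (truncated subtraction makes the 2k ≤ m case give 0 ≤ 5m²).
leφ : ℕ → ℕ → Bool
leφ m k = ((2 * k ∸ m) ^ 2) ≤ᵇ (5 * (m * m))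

countLe : ℕ → ℕ → ℕ
countLe m zero = zero
countLe m (suc j) = (if leφ m (suc j) then 1 else 0) + countLe m j

-- ⌊ m φ ⌋ = #{k ∈ {1,…,2m} : k ≤ m φ}  (since m φ < 2m for m ≥ 1, and ⌊0·φ⌋ = 0)
floorφ : ℕ → ℕ
floorφ m = countLe m (2 * m)

σ₁ : ℕ → List ℕ
σ₁ 2 = 2 ∷ 1 ∷ []
σ₁ _ = 2 ∷ []

σ : List ℕ → List ℕ
σ = concatMap σ₁

-- C 1 = (1,1,1,1,1),  C (i+1) = σ (C i)   (C 0 is a dummy, unused)
C : ℕ → List ℕ
C zero = []
C (suc zero) = 1 ∷ 1 ∷ 1 ∷ 1 ∷ 1 ∷ []
C (suc (suc i)) = σ (C (suc i))

prefix : ℕ → List ℕ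
prefix zero = []
prefix (suc k) = prefix k ++ C (suc k)

-- first n terms c_1, …, c_n of the infinite sequence (c_n); each C i has length ≥ 5,
-- so prefix n has length ≥ n
cs : ℕ → List ℕ
cs n = take n (prefix n)

a : ℕ → ℕ
a n = 6 + sum (cs (n ∸ 1))

b : ℕ → ℕ
b n = 12 + sum (map suc (cs (n ∸ 1)))

{-# OPTIONS --safe #-}
module Submission where

-- Let w k = σᵏ(1) (fibWord k), so that w (k+2) = w (k+1) w k, |w k| = F (k+1) and Σ w k = F (k+2).
-- Then C (k+1) = (w k)⁵, so the first 5(F (n+1) − 1) + h F n + t letters of c are C 1 ⋯ C (n−1),
-- h copies of w (n−1) and the first t letters of w (n−1); this gives a and b in closed form up to
-- the sum of those t letters.
-- That partial sum is the floor difference because ⌊(z+1)φ⌋ = 1 + G z, where G z sums the first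
-- z letters of the infinite Fibonacci word lim w (k+1), and w (n+1) begins with w n w (n−1).
-- This Beatty-type identity is proved by strong induction on z: σ gives G (G z) = G z + z and
-- G (G z + 1) = G z + z + 2, every z + 1 is G y or G y + 1 with y ≤ z, and g = ⌊xφ⌋ satisfies
-- ⌊gφ⌋ = g + x − 1 and ⌊(g+1)φ⌋ = g + x + 1, which are checked in ℕ through the sign of the
-- form K² − KX − X².

module GoldenRatio where
  open import Defs
  open import Data.Nat
  open import Data.Nat.Properties
  open import Data.Nat.Tactic.RingSolver using (solve-∀; solve)
  open import Data.Bool using (true; false)
  open import Data.List using ([]; _∷_)
  open import Data.Sum using (inj₁; inj₂)
  open import Relation.Binary.PropositionalEquality
  open import Relation.Nullary using (yes; no; contradiction)
  open import Relation.Nullary.Decidable using (dec-true; dec-false)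

  infix 4 _<φ*_ _>φ*_

  -- For X ≥ 1 these say K < X φ and K > X φ (φ is the positive root of φ² = φ + 1); as φ is
  -- irrational, IsFloorφ X K then says K = ⌊X φ⌋.
  _<φ*_ : ℕ → ℕ → Set
  K <φ* X = K * K < K * X + X * X

  _>φ*_ : ℕ → ℕ → Set
  K >φ* X = K * X + X * X < K * K

  record IsFloorφ (X K : ℕ) : Set where
    constructor bracket
    field
      below : K <φ* X
      above : suc K >φ* X

  cross-< : ∀ {a b c d} → a + b ≡ c + d → b < d → c < a
  cross-< {a} {b} {c} {d} a+b≡c+d b<d = +-cancelʳ-< b c a (begin-strict
    c + b  <⟨ +-monoʳ-< c b<d ⟩
    c + d  ≡⟨ a+b≡c+d ⟨
    a + b  ∎)
    where open ≤-Reasoning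

  -- The form K² − K X − X² changes sign under (K , X) ↦ (K + X , K).
  golden-form-flip : ∀ K X → (K + X) * (K + X) + K * K ≡ ((K + X) * K + K * K) + (K * X + X * X)
  golden-form-flip = solve-∀

  <φ*⇒+>φ* : ∀ {K X} → K <φ* X → K + X >φ* K
  <φ*⇒+>φ* {K} {X} = cross-< (golden-form-flip K X)

  >φ*⇒+<φ* : ∀ {K X} → K >φ* X → K + X <φ* K
  >φ*⇒+<φ* {K} {X} = cross-< (sym (golden-form-flip K X))

  <φ*⇒<2* : ∀ {K X} → K <φ* X → K < 2 * X
  <φ*⇒<2* {K} {X} K<φX with 2 * X ≤? K
  ... | no 2X≰K = ≰⇒> 2X≰K
  ... | yes 2X≤K = contradiction form≤K² (<⇒≱ K<φX)
    where
    form≤K² : K * X + X * X ≤ K * K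
    form≤K² = begin
      K * X + X * X  ≤⟨ +-monoʳ-≤ (K * X) (*-monoˡ-≤ X (≤-trans (m≤m+n X (X + 0)) 2X≤K)) ⟩
      K * X + K * X  ≡⟨ solve (K ∷ X ∷ []) ⟩
      K * (2 * X)    ≤⟨ *-monoʳ-≤ K 2X≤K ⟩
      K * K          ∎
      where open ≤-Reasoning

  suc-square : ∀ K → suc K * suc K ≡ K * K + (K + suc K)
  suc-square = solve-∀

  suc-golden-form : ∀ K X → suc K * suc X + suc X * suc X ≡ (K * X + X * X) + (K + (2 + 3 * X))
  suc-golden-form = solve-∀

  K≤2X⇒K+1+K≤K+2+3X : ∀ K X → K ≤ 2 * X → K + suc K ≤ K + (2 + 3 * X)
  K≤2X⇒K+1+K≤K+2+3X K X K≤2X =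
    +-monoʳ-≤ K (s≤s (≤-trans K≤2X (≤-trans (*-monoˡ-≤ X {2} {3} (s≤s (s≤s z≤n))) (n≤1+n (3 * X)))))

  <φ*-suc : ∀ {K X} → K <φ* X → suc K <φ* suc X
  <φ*-suc {K} {X} K<φX = begin-strict
    suc K * suc K                         ≡⟨ suc-square K ⟩
    K * K + (K + suc K)                   <⟨ +-monoˡ-< (K + suc K) K<φX ⟩
    (K * X + X * X) + (K + suc K)         ≤⟨ +-monoʳ-≤ (K * X + X * X) (K≤2X⇒K+1+K≤K+2+3X K X K≤2X) ⟩
    (K * X + X * X) + (K + (2 + 3 * X))   ≡⟨ suc-golden-form K X ⟨
    suc K * suc X + suc X * suc X         ∎
    where
    open ≤-Reasoning
    K≤2X : K ≤ 2 * X
    K≤2X = <⇒≤ (<φ*⇒<2* K<φX)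

  >φ*-pred : ∀ {K X} → suc K >φ* suc X → K >φ* X
  >φ*-pred {K} {X} 1+K>φ1+X with K ≤? 2 * X
  ... | yes K≤2X = +-cancelʳ-< (K + (2 + 3 * X)) _ _ (begin-strict
    (K * X + X * X) + (K + (2 + 3 * X))   ≡⟨ suc-golden-form K X ⟨
    suc K * suc X + suc X * suc X         <⟨ 1+K>φ1+X ⟩
    suc K * suc K                         ≡⟨ suc-square K ⟩
    K * K + (K + suc K)                   ≤⟨ +-monoʳ-≤ (K * K) (K≤2X⇒K+1+K≤K+2+3X K X K≤2X) ⟩
    K * K + (K + (2 + 3 * X))             ∎)
    where open ≤-Reasoning
  ... | no K≰2X = begin-strict
    K * X + X * X   ≤⟨ +-monoʳ-≤ (K * X) (*-monoˡ-≤ X X≤K) ⟩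
    K * X + K * X   ≡⟨ solve (K ∷ X ∷ []) ⟩
    K * (2 * X)     <⟨ *-monoʳ-< K {{>-nonZero (≤-<-trans z≤n 2X<K)}} 2X<K ⟩
    K * K           ∎
    where
    open ≤-Reasoning
    2X<K : 2 * X < K
    2X<K = ≰⇒> K≰2X
    X≤K : X ≤ K
    X≤K = ≤-trans (m≤m+n X (X + 0)) (<⇒≤ 2X<K)

  -- With D = 2K − X this is D² − 5X² = 4(K² − KX − X²), which links leφ to _<φ*_ and _>φ*_.
  sq-identity : ∀ K X D → X + D ≡ 2 * K → D ^ 2 + 4 * (K * X) ≡ 4 * (K * K) + X * X
  sq-identity K X D X+D≡2K = begin
    D ^ 2 + 4 * (K * X)         ≡⟨ cong (λ y → D * y + 4 * (K * X)) (*-identityʳ D) ⟩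
    D * D + 4 * (K * X)         ≡⟨ solve (D ∷ K ∷ X ∷ []) ⟩
    D * D + 2 * X * (2 * K)     ≡⟨ cong (λ y → D * D + 2 * X * y) X+D≡2K ⟨
    D * D + 2 * X * (X + D)     ≡⟨ solve (D ∷ X ∷ []) ⟩
    (X + D) * (X + D) + X * X   ≡⟨ cong (λ y → y * y + X * X) X+D≡2K ⟩
    (2 * K) * (2 * K) + X * X   ≡⟨ solve (K ∷ X ∷ []) ⟩
    4 * (K * K) + X * X         ∎
    where open ≡-Reasoning

  <φ*⇒sq≤ : ∀ {K X} → K <φ* X → (2 * K ∸ X) ^ 2 ≤ 5 * (X * X)
  <φ*⇒sq≤ {K} {X} K<φX with X ≤? 2 * K
  ... | no X≰2K rewrite m≤n⇒m∸n≡0 (<⇒≤ (≰⇒> X≰2K)) = z≤n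
  ... | yes X≤2K = <⇒≤ (+-cancelʳ-< (4 * (K * X)) _ _ (begin-strict
    (2 * K ∸ X) ^ 2 + 4 * (K * X)   ≡⟨ sq-identity K X _ (m+[n∸m]≡n X≤2K) ⟩
    4 * (K * K) + X * X             <⟨ +-monoˡ-< (X * X) (*-monoʳ-< 4 K<φX) ⟩
    4 * (K * X + X * X) + X * X     ≡⟨ solve (K ∷ X ∷ []) ⟩
    5 * (X * X) + 4 * (K * X)       ∎))
    where open ≤-Reasoning

  >φ*⇒sq> : ∀ {J X} → J >φ* X → 5 * (X * X) < (2 * J ∸ X) ^ 2
  >φ*⇒sq> {J} {X} J>φX = +-cancelʳ-< (4 * (J * X)) _ _ (begin-strict
    5 * (X * X) + 4 * (J * X)       ≡⟨ solve (J ∷ X ∷ []) ⟩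
    4 * (J * X + X * X) + X * X     <⟨ +-monoˡ-< (X * X) (*-monoʳ-< 4 J>φX) ⟩
    4 * (J * J) + X * X             ≡⟨ sq-identity J X _ (m+[n∸m]≡n X≤2J) ⟨
    (2 * J ∸ X) ^ 2 + 4 * (J * X)   ∎)
    where
    open ≤-Reasoning
    X≤2J : X ≤ 2 * J
    X≤2J = ≤-trans (<⇒≤ (*-cancelˡ-< J X J (≤-<-trans (m≤m+n (J * X) (X * X)) J>φX))) (m≤m+n J (J + 0))

  leφ-below : ∀ {K X} → K <φ* X → ∀ {k} → k ≤ K → leφ X k ≡ true
  leφ-below {K} {X} K<φX {k} k≤K = dec-true ((2 * k ∸ X) ^ 2 ≤? 5 * (X * X))
    (≤-trans (^-monoˡ-≤ 2 (∸-monoˡ-≤ X (*-monoʳ-≤ 2 k≤K))) (<φ*⇒sq≤ {K} {X} K<φX))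

  leφ-above : ∀ {J X} → J >φ* X → ∀ {k} → J ≤ k → leφ X k ≡ false
  leφ-above {J} {X} J>φX {k} J≤k = dec-false ((2 * k ∸ X) ^ 2 ≤? 5 * (X * X))
    (<⇒≱ (<-≤-trans (>φ*⇒sq> {J} {X} J>φX) (^-monoˡ-≤ 2 (∸-monoˡ-≤ X (*-monoʳ-≤ 2 J≤k)))))

  countLe-all : ∀ m j → (∀ {k} → k ≤ j → leφ m k ≡ true) → countLe m j ≡ j
  countLe-all m zero _ = refl
  countLe-all m (suc j) all rewrite all ≤-refl = cong suc (countLe-all m j (λ k≤j → all (m≤n⇒m≤1+n k≤j)))

  countLe-threshold : ∀ {m K j} → (∀ {k} → k ≤ K → leφ m k ≡ true) →
                      (∀ {k} → K < k → leφ m k ≡ false) → K ≤ j → countLe m j ≡ K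
  countLe-threshold {j = zero} _ _ z≤n = refl
  countLe-threshold {m} {K} {suc j} below above K≤1+j with m≤n⇒m<n∨m≡n K≤1+j
  ... | inj₂ refl = countLe-all m (suc j) below
  ... | inj₁ K<1+j rewrite above K<1+j = countLe-threshold below above (≤-pred K<1+j)

  floorφ-unique : ∀ {X K} → IsFloorφ X K → floorφ X ≡ K
  floorφ-unique {X} {K} (bracket K<φX 1+K>φX) =
    countLe-threshold (leφ-below {K} {X} K<φX) (leφ-above {suc K} {X} 1+K>φX) (<⇒≤ (<φ*⇒<2* {K} {X} K<φX))

  IsFloorφ-iterate : ∀ {x g} → IsFloorφ (suc x) g → IsFloorφ g (g + x)
  IsFloorφ-iterate {x} {g} (bracket g<φ 1+g>φ) =
    bracket (>φ*⇒+<φ* {g} {x} (>φ*-pred {g} {x} 1+g>φ)) (subst (_>φ* g) (+-suc g x) (<φ*⇒+>φ* {g} {suc x} g<φ))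

  IsFloorφ-iterate-suc : ∀ {x g} → IsFloorφ (suc x) g → IsFloorφ (suc g) (suc (suc (g + x)))
  IsFloorφ-iterate-suc {x} {g} (bracket g<φ 1+g>φ) = bracket
    (subst (_<φ* suc g) (cong suc (+-suc g x)) (>φ*⇒+<φ* {suc g} {suc x} 1+g>φ))
    (subst (_>φ* suc g) (cong suc g+2+x≡) (<φ*⇒+>φ* {suc g} {suc (suc x)} (<φ*-suc {g} {suc x} g<φ)))
    where
    g+2+x≡ : g + suc (suc x) ≡ suc (suc (g + x))
    g+2+x≡ = trans (+-suc g (suc x)) (cong suc (+-suc g x))

module ListPrefixes where
  open import Data.Nat
  open import Data.Nat.Properties
  open import Data.List using (List; []; _∷_; _++_; take; length; concat; replicate)
  open import Data.List.Properties using (++-assoc; ++-identityʳ; length-++; take-all)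
  open import Data.Product using (∃; _,_)
  open import Data.Sum using (inj₁; inj₂)
  open import Relation.Binary.PropositionalEquality

  infix 4 _⊑_

  _⊑_ : {A : Set} → List A → List A → Set
  xs ⊑ ys = ∃ λ rest → ys ≡ xs ++ rest

  module _ {A : Set} where

    ⊑-refl : {xs : List A} → xs ⊑ xs
    ⊑-refl {xs} = [] , sym (++-identityʳ xs)

    ⊑-trans : {xs ys zs : List A} → xs ⊑ ys → ys ⊑ zs → xs ⊑ zs
    ⊑-trans {xs} (r , refl) (s , refl) = r ++ s , ++-assoc xs r s

    ++⁺-⊑ : (xs : List A) {ys zs : List A} → ys ⊑ zs → xs ++ ys ⊑ xs ++ zs
    ++⁺-⊑ xs {ys} (r , refl) = r , sym (++-assoc xs ys r)

    ⊑-++ : (xs ys : List A) → xs ⊑ xs ++ ys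
    ⊑-++ xs ys = ys , refl

    ⊑-length : {xs ys : List A} → xs ⊑ ys → length xs ≤ length ys
    ⊑-length {xs} (r , refl) = ≤-trans (m≤m+n (length xs) (length r)) (≤-reflexive (sym (length-++ xs)))

    take-++ : ∀ m (xs ys : List A) → m ≤ length xs → take m (xs ++ ys) ≡ take m xs
    take-++ zero xs ys _ = refl
    take-++ (suc m) (x ∷ xs) ys (s≤s m≤len) = cong (x ∷_) (take-++ m xs ys m≤len)

    take-length-++ : (xs ys : List A) (m : ℕ) → take (length xs + m) (xs ++ ys) ≡ xs ++ take m ys
    take-length-++ [] ys m = refl
    take-length-++ (x ∷ xs) ys m = cong (x ∷_) (take-length-++ xs ys m)

    take-⊑ : ∀ m {xs ys : List A} → xs ⊑ ys → m ≤ length xs → take m ys ≡ take m xs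
    take-⊑ m {xs} (r , refl) = take-++ m xs r

    take-length-⊑ : {xs ys : List A} → xs ⊑ ys → take (length xs) ys ≡ xs
    take-length-⊑ {xs} xs⊑ = trans (take-⊑ (length xs) xs⊑ ≤-refl) (take-all (length xs) xs ≤-refl)

    length-concat-replicate : ∀ h (w : List A) → length (concat (replicate h w)) ≡ h * length w
    length-concat-replicate zero w = refl
    length-concat-replicate (suc h) w = trans (length-++ w) (cong (length w +_) (length-concat-replicate h w))

    take-concat-replicate : ∀ {h H t} (w : List A) → h < H → t ≤ length w →
                            take (h * length w + t) (concat (replicate H w)) ≡ concat (replicate h w) ++ take t w
    take-concat-replicate {zero} {suc H} {t} w _ t≤len = take-++ t w (concat (replicate H w)) t≤len
    take-concat-replicate {suc h} {suc H} {t} w (s≤s h<H) t≤len = begin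
      take (length w + h * length w + t) (w ++ rest)       ≡⟨ cong (λ m → take m (w ++ rest)) (+-assoc (length w) (h * length w) t) ⟩
      take (length w + (h * length w + t)) (w ++ rest)     ≡⟨ take-length-++ w rest (h * length w + t) ⟩
      w ++ take (h * length w + t) rest                    ≡⟨ cong (w ++_) (take-concat-replicate w h<H t≤len) ⟩
      w ++ (concat (replicate h w) ++ take t w)            ≡⟨ ++-assoc w (concat (replicate h w)) (take t w) ⟨
      (w ++ concat (replicate h w)) ++ take t w            ∎
      where
      open ≡-Reasoning
      rest = concat (replicate H w)

    PrefixChain : (ℕ → List A) → Set
    PrefixChain w = ∀ k → w k ⊑ w (suc k)

    chain-⊑ : {w : ℕ → List A} → PrefixChain w → ∀ {k j} → k ≤ j → w k ⊑ w j
    chain-⊑ chain {j = zero} z≤n = ⊑-refl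
    chain-⊑ chain {j = suc j} k≤1+j with m≤n⇒m<n∨m≡n k≤1+j
    ... | inj₂ refl = ⊑-refl
    ... | inj₁ k<1+j = ⊑-trans (chain-⊑ chain (≤-pred k<1+j)) (chain j)

    take-chain : {w : ℕ → List A} → PrefixChain w →
                 ∀ {m k j} → m ≤ length (w k) → m ≤ length (w j) → take m (w k) ≡ take m (w j)
    take-chain chain {m} {k} {j} m≤k m≤j with ≤-total k j
    ... | inj₁ k≤j = sym (take-⊑ m (chain-⊑ chain k≤j) m≤k)
    ... | inj₂ j≤k = take-⊑ m (chain-⊑ chain j≤k) m≤j

module FibonacciWord where
  open import Defs
  open GoldenRatio
  open ListPrefixes
  open import Data.Nat
  open import Data.Nat.Properties
  open import Data.Nat.Induction using (<-rec)
  open import Data.Nat.ListAction using (sum)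
  open import Data.Nat.ListAction.Properties using (sum-++)
  open import Data.List using (List; _∷_; _++_; [_]; take; length)
  open import Data.List.Properties using (++-assoc; length-++; length-take; concatMap-++)
  open import Data.List.Relation.Unary.All using (All; []; _∷_)
  open import Data.List.Relation.Unary.All.Properties using (take⁺)
  open import Data.Product using (∃; _×_; _,_)
  open import Data.Sum using (_⊎_; inj₁; inj₂)
  open import Relation.Binary.PropositionalEquality hiding ([_])

  Letter : ℕ → Set
  Letter x = x ≡ 1 ⊎ x ≡ 2

  σ-++ : (xs ys : List ℕ) → σ (xs ++ ys) ≡ σ xs ++ σ ys
  σ-++ = concatMap-++ σ₁

  σ-letters : ∀ {xs} → All Letter xs → All Letter (σ xs)
  σ-letters [] = []
  σ-letters (inj₁ refl ∷ ls) = inj₂ refl ∷ σ-letters ls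
  σ-letters (inj₂ refl ∷ ls) = inj₂ refl ∷ inj₁ refl ∷ σ-letters ls

  length-σ : ∀ {xs} → All Letter xs → length (σ xs) ≡ sum xs
  length-σ [] = refl
  length-σ (inj₁ refl ∷ ls) = cong suc (length-σ ls)
  length-σ (inj₂ refl ∷ ls) = cong (2 +_) (length-σ ls)

  sum-σ : ∀ {xs} → All Letter xs → sum (σ xs) ≡ sum xs + length xs
  sum-σ [] = refl
  sum-σ {1 ∷ xs} (inj₁ refl ∷ ls) = trans (cong (2 +_) (sum-σ ls)) (sym (+-suc (1 + sum xs) (length xs)))
  sum-σ {2 ∷ xs} (inj₂ refl ∷ ls) = trans (cong (3 +_) (sum-σ ls)) (sym (+-suc (2 + sum xs) (length xs)))

  σ₁-starts-with-2 : ∀ x → [ 2 ] ⊑ σ₁ x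
  σ₁-starts-with-2 zero = ⊑-refl
  σ₁-starts-with-2 1 = ⊑-refl
  σ₁-starts-with-2 2 = ⊑-++ [ 2 ] [ 1 ]
  σ₁-starts-with-2 (suc (suc (suc _))) = ⊑-refl

  σ-take-⊑ : ∀ m xs → m < length xs → σ (take m xs) ++ [ 2 ] ⊑ σ xs
  σ-take-⊑ zero (x ∷ xs) _ = ⊑-trans (σ₁-starts-with-2 x) (⊑-++ (σ₁ x) (σ xs))
  σ-take-⊑ (suc m) (x ∷ xs) (s≤s m<len) =
    subst (_⊑ σ (x ∷ xs)) (sym (++-assoc (σ₁ x) (σ (take m xs)) [ 2 ])) (++⁺-⊑ (σ₁ x) (σ-take-⊑ m xs m<len))

  sum-take-suc : ∀ m {xs} → All Letter xs → m < length xs →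
                 sum (take (suc m) xs) ≡ suc (sum (take m xs)) ⊎ sum (take (suc m) xs) ≡ suc (suc (sum (take m xs)))
  sum-take-suc zero (inj₁ refl ∷ _) _ = inj₁ refl
  sum-take-suc zero (inj₂ refl ∷ _) _ = inj₂ refl
  sum-take-suc (suc m) {x ∷ xs} (_ ∷ ls) (s≤s m<len) with sum-take-suc m ls m<len
  ... | inj₁ e = inj₁ (trans (cong (x +_) e) (+-suc x _))
  ... | inj₂ e = inj₂ (trans (cong (x +_) e) (trans (+-suc x _) (cong suc (+-suc x _))))

  fibWord : ℕ → List ℕ
  fibWord zero = [ 1 ]
  fibWord (suc k) = σ (fibWord k)

  fibWord-rec : ∀ k → fibWord (suc (suc k)) ≡ fibWord (suc k) ++ fibWord k
  fibWord-rec zero = refl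
  fibWord-rec (suc k) = trans (cong σ (fibWord-rec k)) (σ-++ (fibWord (suc k)) (fibWord k))

  fibWord-letters : ∀ k → All Letter (fibWord k)
  fibWord-letters zero = inj₁ refl ∷ []
  fibWord-letters (suc k) = σ-letters (fibWord-letters k)

  length-fibWord : ∀ k → length (fibWord k) ≡ F (suc k)
  length-fibWord zero = refl
  length-fibWord (suc zero) = refl
  length-fibWord (suc (suc k)) = begin
    length (fibWord (suc (suc k)))                    ≡⟨ cong length (fibWord-rec k) ⟩
    length (fibWord (suc k) ++ fibWord k)             ≡⟨ length-++ (fibWord (suc k)) ⟩
    length (fibWord (suc k)) + length (fibWord k)     ≡⟨ cong₂ _+_ (length-fibWord (suc k)) (length-fibWord k) ⟩
    F (suc (suc k)) + F (suc k)                       ∎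
    where open ≡-Reasoning

  sum-fibWord : ∀ k → sum (fibWord k) ≡ F (suc (suc k))
  sum-fibWord zero = refl
  sum-fibWord (suc zero) = refl
  sum-fibWord (suc (suc k)) = begin
    sum (fibWord (suc (suc k)))                 ≡⟨ cong sum (fibWord-rec k) ⟩
    sum (fibWord (suc k) ++ fibWord k)          ≡⟨ sum-++ (fibWord (suc k)) (fibWord k) ⟩
    sum (fibWord (suc k)) + sum (fibWord k)     ≡⟨ cong₂ _+_ (sum-fibWord (suc k)) (sum-fibWord k) ⟩
    F (suc (suc (suc k))) + F (suc (suc k))     ∎
    where open ≡-Reasoning

  n<F[2+n] : ∀ k → suc k ≤ F (suc (suc k))
  n<F[2+n] zero = s≤s z≤n
  n<F[2+n] (suc zero) = s≤s (s≤s z≤n)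
  n<F[2+n] (suc (suc k)) = subst (_≤ F (suc (suc (suc k))) + F (suc (suc k))) (+-comm (suc (suc k)) 1)
    (+-mono-≤ (n<F[2+n] (suc k)) (≤-trans (s≤s z≤n) (n<F[2+n] k)))

  n<length-fibWord[1+n] : ∀ k → k < length (fibWord (suc k))
  n<length-fibWord[1+n] k = subst (k <_) (sym (length-fibWord (suc k))) (n<F[2+n] k)

  fibWord-chain : PrefixChain (λ k → fibWord (suc k))
  fibWord-chain k = fibWord k , fibWord-rec k

  -- The words fibWord (suc k) = 2, 21, 212, 21221, … each extend the previous one; G z sums the
  -- first z letters of their limit, all of which fibWord (suc z) already contains.
  G : ℕ → ℕ
  G z = sum (take z (fibWord (suc z)))

  G-take : ∀ k {m} → m ≤ length (fibWord (suc k)) → G m ≡ sum (take m (fibWord (suc k)))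
  G-take k {m} m≤len = cong sum (take-chain fibWord-chain {m} {m} {k} (<⇒≤ (n<length-fibWord[1+n] m)) m≤len)

  G-⊑ : ∀ k {xs} → xs ⊑ fibWord (suc k) → G (length xs) ≡ sum xs
  G-⊑ k xs⊑ = trans (G-take k (⊑-length xs⊑)) (cong sum (take-length-⊑ xs⊑))

  G-step : ∀ y → G (suc y) ≡ suc (G y) ⊎ G (suc y) ≡ suc (suc (G y))
  G-step y = subst (λ g → G (suc y) ≡ suc g ⊎ G (suc y) ≡ suc (suc g)) (sym (G-take (suc y) (<⇒≤ y<len)))
    (sum-take-suc y (fibWord-letters (suc (suc y))) y<len)
    where
    y<len : y < length (fibWord (suc (suc y)))
    y<len = <⇒≤ (n<length-fibWord[1+n] (suc y))

  module _ (z : ℕ) where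
    private
      p = take z (fibWord (suc z))

      p-letters : All Letter p
      p-letters = take⁺ z (fibWord-letters (suc z))

      σp2⊑ : σ p ++ [ 2 ] ⊑ fibWord (suc (suc z))
      σp2⊑ = σ-take-⊑ z (fibWord (suc z)) (n<length-fibWord[1+n] z)

      length-σp : length (σ p) ≡ G z
      length-σp = length-σ p-letters

      sum-σp : sum (σ p) ≡ G z + z
      sum-σp = trans (sum-σ p-letters)
        (cong (G z +_) (trans (length-take z (fibWord (suc z))) (m≤n⇒m⊓n≡m (<⇒≤ (n<length-fibWord[1+n] z)))))

    G-iterate : G (G z) ≡ G z + z
    G-iterate = begin
      G (G z)            ≡⟨ cong G length-σp ⟨
      G (length (σ p))   ≡⟨ G-⊑ (suc z) (⊑-trans (⊑-++ (σ p) [ 2 ]) σp2⊑) ⟩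
      sum (σ p)          ≡⟨ sum-σp ⟩
      G z + z            ∎
      where open ≡-Reasoning

    G-iterate-suc : G (suc (G z)) ≡ suc (suc (G z + z))
    G-iterate-suc = begin
      G (suc (G z))                ≡⟨ cong G length-σp2 ⟨
      G (length (σ p ++ [ 2 ]))    ≡⟨ G-⊑ (suc z) σp2⊑ ⟩
      sum (σ p ++ [ 2 ])           ≡⟨ sum-++ (σ p) [ 2 ] ⟩
      sum (σ p) + 2                ≡⟨ cong (_+ 2) sum-σp ⟩
      G z + z + 2                  ≡⟨ +-comm (G z + z) 2 ⟩
      suc (suc (G z + z))          ∎
      where
      open ≡-Reasoning
      length-σp2 : length (σ p ++ [ 2 ]) ≡ suc (G z)
      length-σp2 = trans (length-++ (σ p)) (trans (+-comm (length (σ p)) 1) (cong suc length-σp))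

  G-covers : ∀ z → ∃ λ y → y < suc z × (suc z ≡ G y ⊎ suc z ≡ suc (G y))
  G-covers zero = 0 , s≤s z≤n , inj₂ refl
  G-covers (suc z) with G-covers z
  ... | y , y<1+z , inj₁ 1+z≡Gy = y , m<n⇒m<1+n y<1+z , inj₂ (cong suc 1+z≡Gy)
  ... | y , y<1+z , inj₂ 1+z≡1+Gy with G-step y
  ...   | inj₁ e = suc y , s≤s y<1+z , inj₂ (cong suc (trans 1+z≡1+Gy (sym e)))
  ...   | inj₂ e = suc y , s≤s y<1+z , inj₁ (trans (cong suc 1+z≡1+Gy) (sym e))

  GFloor : ℕ → Set
  GFloor z = IsFloorφ (suc z) (suc (G z))

  GFloor-G : ∀ {y} → GFloor y → GFloor (G y)
  GFloor-G {y} b = subst (IsFloorφ (suc (G y))) (cong suc (sym (G-iterate y))) (IsFloorφ-iterate b)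

  GFloor-suc-G : ∀ {y} → GFloor y → GFloor (suc (G y))
  GFloor-suc-G {y} b = subst (IsFloorφ (suc (suc (G y)))) (cong suc (sym (G-iterate-suc y))) (IsFloorφ-iterate-suc b)

  GFloor-all : ∀ z → GFloor z
  GFloor-all = <-rec GFloor step
    where
    step : ∀ z → (∀ {y} → y < z → GFloor y) → GFloor z
    step zero _ = bracket ≤-refl ≤-refl
    step (suc z) rec with G-covers z
    ... | y , y<1+z , inj₁ 1+z≡Gy = subst GFloor (sym 1+z≡Gy) (GFloor-G (rec y<1+z))
    ... | y , y<1+z , inj₂ 1+z≡1+Gy = subst GFloor (sym 1+z≡1+Gy) (GFloor-suc-G (rec y<1+z))

  floorφ-suc : ∀ z → floorφ (suc z) ≡ suc (G z)
  floorφ-suc z = floorφ-unique (GFloor-all z)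

  G-fibWord : ∀ n {t} → t ≤ F (suc n) →
              G (length (fibWord (suc n)) + t) ≡ G (length (fibWord (suc n))) + sum (take t (fibWord n))
  G-fibWord n {t} t≤F = begin
    G (L + t)                                          ≡⟨ G-take (suc n) L+t≤ ⟩
    sum (take (L + t) (fibWord (suc (suc n))))         ≡⟨ cong (λ ws → sum (take (L + t) ws)) (fibWord-rec n) ⟩
    sum (take (L + t) (fibWord (suc n) ++ fibWord n))  ≡⟨ cong sum (take-length-++ (fibWord (suc n)) (fibWord n) t) ⟩
    sum (fibWord (suc n) ++ take t (fibWord n))        ≡⟨ sum-++ (fibWord (suc n)) (take t (fibWord n)) ⟩
    sum (fibWord (suc n)) + sum (take t (fibWord n))   ≡⟨ cong (_+ sum (take t (fibWord n))) (G-⊑ (suc n) (fibWord-chain n)) ⟨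
    G L + sum (take t (fibWord n))                     ∎
    where
    open ≡-Reasoning
    L = length (fibWord (suc n))
    L+t≤ : L + t ≤ length (fibWord (suc (suc n)))
    L+t≤ = subst (L + t ≤_) (sym (trans (cong length (fibWord-rec n)) (length-++ (fibWord (suc n)))))
      (+-monoʳ-≤ L (subst (t ≤_) (sym (length-fibWord n)) t≤F))

  floorφ-block : ∀ n {t} → t ≤ F (suc n) →
                 floorφ (F (suc (suc n)) + 1 + t) ≡ floorφ (F (suc (suc n)) + 1) + sum (take t (fibWord n))
  floorφ-block n {t} t≤F = begin
    floorφ (F (suc (suc n)) + 1 + t)   ≡⟨ cong (λ x → floorφ (x + t)) F+1≡1+L ⟩
    floorφ (suc (L + t))               ≡⟨ floorφ-suc (L + t) ⟩
    suc (G (L + t))                    ≡⟨ cong suc (G-fibWord n t≤F) ⟩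
    suc (G L) + S                      ≡⟨ cong (_+ S) (floorφ-suc L) ⟨
    floorφ (suc L) + S                 ≡⟨ cong (λ x → floorφ x + S) F+1≡1+L ⟨
    floorφ (F (suc (suc n)) + 1) + S   ∎
    where
    open ≡-Reasoning
    L = length (fibWord (suc n))
    S = sum (take t (fibWord n))
    F+1≡1+L : F (suc (suc n)) + 1 ≡ suc L
    F+1≡1+L = trans (+-comm (F (suc (suc n))) 1) (cong suc (sym (length-fibWord (suc n))))

module Blocks where
  open import Defs
  open ListPrefixes
  open FibonacciWord
  open import Data.Nat
  open import Data.Nat.Properties
  open import Data.Nat.ListAction using (sum)
  open import Data.Nat.ListAction.Properties using (sum-++)
  open import Data.List using ([]; _∷_; _++_; take; length; map; concat; replicate)
  open import Data.List.Properties using (length-++; length-take)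
  open import Data.Product using (_,_)
  open import Relation.Binary.PropositionalEquality

  σ-concat-replicate : ∀ h w → σ (concat (replicate h w)) ≡ concat (replicate h (σ w))
  σ-concat-replicate zero w = refl
  σ-concat-replicate (suc h) w = trans (σ-++ w (concat (replicate h w))) (cong (σ w ++_) (σ-concat-replicate h w))

  C-fibWord : ∀ k → C (suc k) ≡ concat (replicate 5 (fibWord k))
  C-fibWord zero = refl
  C-fibWord (suc k) = trans (cong σ (C-fibWord k)) (σ-concat-replicate 5 (fibWord k))

  sum-concat-replicate : ∀ h w → sum (concat (replicate h w)) ≡ h * sum w
  sum-concat-replicate zero w = refl
  sum-concat-replicate (suc h) w = trans (sum-++ w (concat (replicate h w))) (cong (sum w +_) (sum-concat-replicate h w))

  sum-map-suc : ∀ xs → sum (map suc xs) ≡ sum xs + length xs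
  sum-map-suc [] = refl
  sum-map-suc (x ∷ xs) = begin
    suc (x + sum (map suc xs))           ≡⟨ cong (λ s → suc (x + s)) (sum-map-suc xs) ⟩
    suc (x + (sum xs + length xs))       ≡⟨ cong suc (+-assoc x (sum xs) (length xs)) ⟨
    suc (x + sum xs + length xs)         ≡⟨ +-suc (x + sum xs) (length xs) ⟨
    x + sum xs + suc (length xs)         ∎
    where open ≡-Reasoning

  length-prefix : ∀ k → 5 + length (prefix k) ≡ 5 * F (suc (suc k))
  length-prefix zero = refl
  length-prefix (suc k) = begin
    5 + length (prefix k ++ C (suc k))               ≡⟨ cong (5 +_) (length-++ (prefix k)) ⟩
    5 + (length (prefix k) + length (C (suc k)))     ≡⟨ +-assoc 5 (length (prefix k)) _ ⟨
    5 + length (prefix k) + length (C (suc k))       ≡⟨ cong₂ _+_ (length-prefix k) length-C ⟩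
    5 * F (suc (suc k)) + 5 * F (suc k)              ≡⟨ *-distribˡ-+ 5 (F (suc (suc k))) (F (suc k)) ⟨
    5 * F (suc (suc (suc k)))                        ∎
    where
    open ≡-Reasoning
    length-C : length (C (suc k)) ≡ 5 * F (suc k)
    length-C = trans (cong length (C-fibWord k))
      (trans (length-concat-replicate 5 (fibWord k)) (cong (5 *_) (length-fibWord k)))

  sum-prefix : ∀ k → 10 + sum (prefix k) ≡ 5 * F (suc (suc (suc k)))
  sum-prefix zero = refl
  sum-prefix (suc k) = begin
    10 + sum (prefix k ++ C (suc k))                 ≡⟨ cong (10 +_) (sum-++ (prefix k) (C (suc k))) ⟩
    10 + (sum (prefix k) + sum (C (suc k)))          ≡⟨ +-assoc 10 (sum (prefix k)) _ ⟨
    10 + sum (prefix k) + sum (C (suc k))            ≡⟨ cong₂ _+_ (sum-prefix k) sum-C ⟩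
    5 * F (suc (suc (suc k))) + 5 * F (suc (suc k))  ≡⟨ *-distribˡ-+ 5 (F (suc (suc (suc k)))) (F (suc (suc k))) ⟨
    5 * F (suc (suc (suc (suc k))))                  ∎
    where
    open ≡-Reasoning
    sum-C : sum (C (suc k)) ≡ 5 * F (suc (suc k))
    sum-C = trans (cong sum (C-fibWord k))
      (trans (sum-concat-replicate 5 (fibWord k)) (cong (5 *_) (sum-fibWord k)))

  length-prefix-∸ : ∀ k → 5 * (F (suc (suc k)) ∸ 1) ≡ length (prefix k)
  length-prefix-∸ k = begin
    5 * (F (suc (suc k)) ∸ 1)       ≡⟨ *-distribˡ-∸ 5 (F (suc (suc k))) 1 ⟩
    5 * F (suc (suc k)) ∸ 5         ≡⟨ cong (_∸ 5) (length-prefix k) ⟨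
    5 + length (prefix k) ∸ 5       ≡⟨ m+n∸m≡n 5 (length (prefix k)) ⟩
    length (prefix k)               ∎
    where open ≡-Reasoning

  length-prefix-≥ : ∀ k → k ≤ length (prefix k)
  length-prefix-≥ k = +-cancelˡ-≤ 5 k (length (prefix k)) (begin
    5 + k                  ≤⟨ +-monoʳ-≤ 5 (m≤n*m k 5) ⟩
    5 + 5 * k              ≡⟨ *-suc 5 k ⟨
    5 * suc k              ≤⟨ *-monoʳ-≤ 5 (n<F[2+n] k) ⟩
    5 * F (suc (suc k))    ≡⟨ length-prefix k ⟨
    5 + length (prefix k)  ∎)
    where open ≤-Reasoning

  prefix-chain : PrefixChain prefix
  prefix-chain k = C (suc k) , refl

  cs-take : ∀ {m k} → m ≤ length (prefix k) → cs m ≡ take m (prefix k)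
  cs-take {m} {k} = take-chain prefix-chain {m} {m} {k} (length-prefix-≥ m)

  length-cs : ∀ m → length (cs m) ≡ m
  length-cs m = trans (length-take m (prefix m)) (m≤n⇒m⊓n≡m (length-prefix-≥ m))

  block-index : ∀ n h t →
                5 * (F (suc (suc n)) ∸ 1) + h * F (suc n) + t ≡ length (prefix n) + (h * F (suc n) + t)
  block-index n h t = trans (+-assoc _ (h * F (suc n)) t) (cong (_+ (h * F (suc n) + t)) (length-prefix-∸ n))

  offset-≤-length-C : ∀ n {h t} → h ≤ 4 → t ≤ length (fibWord n) →
                      h * length (fibWord n) + t ≤ length (C (suc n))
  offset-≤-length-C n {h} {t} h≤4 t≤len = begin
    h * length w + t                   ≤⟨ +-mono-≤ (*-monoˡ-≤ (length w) h≤4) t≤len ⟩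
    4 * length w + length w            ≡⟨ +-comm (4 * length w) (length w) ⟩
    5 * length w                       ≡⟨ length-concat-replicate 5 w ⟨
    length (concat (replicate 5 w))    ≡⟨ cong length (C-fibWord n) ⟨
    length (C (suc n))                 ∎
    where
    open ≤-Reasoning
    w = fibWord n

  cs-block : ∀ n {h t} → h ≤ 4 → t ≤ F (suc n) →
             cs (length (prefix n) + (h * F (suc n) + t))
               ≡ prefix n ++ (concat (replicate h (fibWord n)) ++ take t (fibWord n))
  cs-block n {h} {t} h≤4 t≤F = begin
    cs (length P + (h * F (suc n) + t))          ≡⟨ cong (λ f → cs (length P + (h * f + t))) (length-fibWord n) ⟨
    cs (length P + m)                            ≡⟨ cs-take {k = suc n} m≤length-prefix ⟩
    take (length P + m) (P ++ C (suc n))         ≡⟨ take-length-++ P (C (suc n)) m ⟩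
    P ++ take m (C (suc n))                      ≡⟨ cong (λ c → P ++ take m c) (C-fibWord n) ⟩
    P ++ take m (concat (replicate 5 w))         ≡⟨ cong (P ++_) (take-concat-replicate w (s≤s h≤4) t≤len) ⟩
    P ++ (concat (replicate h w) ++ take t w)    ∎
    where
    open ≡-Reasoning
    P = prefix n
    w = fibWord n
    m = h * length w + t
    t≤len : t ≤ length w
    t≤len = subst (t ≤_) (sym (length-fibWord n)) t≤F
    m≤length-prefix : length P + m ≤ length (P ++ C (suc n))
    m≤length-prefix = subst (length P + m ≤_) (sym (length-++ P)) (+-monoʳ-≤ (length P) (offset-≤-length-C n h≤4 t≤len))

  sum-cs-block : ∀ n {h t} → h ≤ 4 → t ≤ F (suc n) →
                 sum (cs (5 * (F (suc (suc n)) ∸ 1) + h * F (suc n) + t))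
                   ≡ sum (prefix n) + (h * F (suc (suc n)) + sum (take t (fibWord n)))
  sum-cs-block n {h} {t} h≤4 t≤F = begin
    sum (cs (5 * (F (suc (suc n)) ∸ 1) + h * F (suc n) + t))  ≡⟨ cong (λ m → sum (cs m)) (block-index n h t) ⟩
    sum (cs (length P + (h * F (suc n) + t)))                 ≡⟨ cong sum (cs-block n h≤4 t≤F) ⟩
    sum (P ++ (concat (replicate h w) ++ take t w))           ≡⟨ sum-++ P _ ⟩
    sum P + sum (concat (replicate h w) ++ take t w)          ≡⟨ cong (sum P +_) (sum-++ (concat (replicate h w)) (take t w)) ⟩
    sum P + (sum (concat (replicate h w)) + sum (take t w))   ≡⟨ cong (λ x → sum P + (x + sum (take t w))) sum-hw ⟩
    sum P + (h * F (suc (suc n)) + sum (take t w))            ∎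
    where
    open ≡-Reasoning
    P = prefix n
    w = fibWord n
    sum-hw : sum (concat (replicate h w)) ≡ h * F (suc (suc n))
    sum-hw = trans (sum-concat-replicate h w) (cong (h *_) (sum-fibWord n))

  a-suc : ∀ m → a (m + 1) ≡ 6 + sum (cs m)
  a-suc m = cong (λ k → 6 + sum (cs k)) (m+n∸n≡m m 1)

  b-suc : ∀ m → b (m + 1) ≡ 12 + (sum (cs m) + m)
  b-suc m = begin
    12 + sum (map suc (cs (m + 1 ∸ 1)))   ≡⟨ cong (λ k → 12 + sum (map suc (cs k))) (m+n∸n≡m m 1) ⟩
    12 + sum (map suc (cs m))             ≡⟨ cong (12 +_) (sum-map-suc (cs m)) ⟩
    12 + (sum (cs m) + length (cs m))     ≡⟨ cong (λ l → 12 + (sum (cs m) + l)) (length-cs m) ⟩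
    12 + (sum (cs m) + m)                 ∎
    where open ≡-Reasoning

open import Defs
open import Data.Nat as ℕ using (ℕ; _≤_; _∸_)
open import Data.Integer using (ℤ; +_; _+_; _-_)
open import Data.Product using (_×_)
open import Relation.Binary.PropositionalEquality using (_≡_)
open import Data.Nat.Properties using (+-comm; *-distribˡ-+)
open import Data.Nat.ListAction using (sum)
open import Data.List using (take; length)
open import Data.Integer.Tactic.RingSolver using (solve-∀)
open import Data.Product using (_,_)
open import Relation.Binary.PropositionalEquality using (refl; sym; trans; cong; cong₂)
open FibonacciWord using (fibWord; floorφ-block)
open Blocks using (a-suc; b-suc; sum-cs-block; block-index; sum-prefix; length-prefix)

-- Each hypothesis names an ℕ quantity; once they are matched with refl the claim is a ring identity in ℤ.
ℤ-formula-i : ∀ sP hF₂ S f {A c f′} → A ≡ 6 ℕ.+ (sP ℕ.+ (hF₂ ℕ.+ S)) → 10 ℕ.+ sP ≡ c → f′ ≡ f ℕ.+ S →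
              + A ≡ + c - + 4 + + hF₂ + (+ f′ - + f)
ℤ-formula-i sP hF₂ S f refl refl refl = identity (+ sP) (+ hF₂) (+ S) (+ f)
  where
  identity : ∀ sP hF₂ S f → + 6 + (sP + (hF₂ + S)) ≡ + 10 + sP - + 4 + hF₂ + ((f + S) - f)
  identity = solve-∀

ℤ-formula-ii : ∀ sP lP hF₁ hF₂ S t f {B c d f′} →
               B ≡ 12 ℕ.+ ((sP ℕ.+ (hF₂ ℕ.+ S)) ℕ.+ (lP ℕ.+ (hF₁ ℕ.+ t))) → (10 ℕ.+ sP) ℕ.+ (5 ℕ.+ lP) ≡ c →
               hF₂ ℕ.+ hF₁ ≡ d → f′ ≡ f ℕ.+ S → + B ≡ + c + + d - + 3 + + t + (+ f′ - + f)
ℤ-formula-ii sP lP hF₁ hF₂ S t f refl refl refl refl = identity (+ sP) (+ lP) (+ hF₁) (+ hF₂) (+ S) (+ t) (+ f)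
  where
  identity : ∀ sP lP hF₁ hF₂ S t f →
             + 12 + ((sP + (hF₂ + S)) + (lP + (hF₁ + t)))
               ≡ (+ 10 + sP) + (+ 5 + lP) + (hF₂ + hF₁) - + 3 + t + ((f + S) - f)
  identity = solve-∀

theorem4p4 : (n h t : ℕ) → 1 ≤ n → h ≤ 4 → 1 ≤ t → t ≤ F n →
    (+ a (5 ℕ.* (F (n ℕ.+ 1) ∸ 1) ℕ.+ h ℕ.* F n ℕ.+ t ℕ.+ 1)
      ≡ + (5 ℕ.* F (n ℕ.+ 2)) - + 4 + + (h ℕ.* F (n ℕ.+ 1))
        + (+ floorφ (F (n ℕ.+ 1) ℕ.+ 1 ℕ.+ t) - + floorφ (F (n ℕ.+ 1) ℕ.+ 1)))
    × (+ b (5 ℕ.* (F (n ℕ.+ 1) ∸ 1) ℕ.+ h ℕ.* F n ℕ.+ t ℕ.+ 1)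
      ≡ + (5 ℕ.* F (n ℕ.+ 3)) + + (h ℕ.* F (n ℕ.+ 2)) - + 3 + + t
        + (+ floorφ (F (n ℕ.+ 1) ℕ.+ 1 ℕ.+ t) - + floorφ (F (n ℕ.+ 1) ℕ.+ 1)))
theorem4p4 ℕ.zero _ _ () _ _ _
theorem4p4 (ℕ.suc n) h t _ h≤4 _ t≤F rewrite +-comm n 1 | +-comm n 2 | +-comm n 3 =
  ℤ-formula-i sP hF₂ S f
    (trans (a-suc J) (cong (6 ℕ.+_) (sum-cs-block n h≤4 t≤F)))
    (sum-prefix n)
    (floorφ-block n t≤F) ,
  ℤ-formula-ii sP lP hF₁ hF₂ S t f
    (trans (b-suc J) (cong₂ (λ s m → 12 ℕ.+ (s ℕ.+ m)) (sum-cs-block n h≤4 t≤F) (block-index n h t)))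
    (trans (cong₂ ℕ._+_ (sum-prefix n) (length-prefix n)) (sym (*-distribˡ-+ 5 F₃ F₂)))
    (sym (*-distribˡ-+ h F₂ F₁))
    (floorφ-block n t≤F)
  where
  F₁ = F (ℕ.suc n)
  F₂ = F (ℕ.suc (ℕ.suc n))
  F₃ = F (ℕ.suc (ℕ.suc (ℕ.suc n)))
  J = 5 ℕ.* (F₂ ∸ 1) ℕ.+ h ℕ.* F₁ ℕ.+ t
  hF₁ = h ℕ.* F₁
  hF₂ = h ℕ.* F₂
  sP = sum (prefix n)
  lP = length (prefix n)
  S = sum (take t (fibWord n))
  f = floorφ (F₂ ℕ.+ 1)
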